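{- Let $P$ be an enhanced Gelfand--Zetlin pattern with top row $\lambda$, regarded as a graph whose vertices are its entries and whose edges are the edges of $P$. Then: (1) two entries of row $0$ lie in the same connected component if and only if they have the same value; (2) each connected component either has a unique vertex in its topmost row or contains at least one entry of row $0$; (3) all vertices of a connected component, except possibly the highest one, are encircled; in particular, the number of connected components is at least the number of distinct values among $\lambda_1,\dots,\lambda_n$ plus the number of non-encircled entries.
   Context: $\lambda=(\lambda_1\ge\dots\ge\lambda_n)$ is a partition. A Gelfand--Zetlin pattern is an integer array $(a_{ij})_{0\le i\le n-1,\,1\le j\le n-i}$ with $a_{0j}=\lambda_{n+1-j}$ and $a_{i-1,j}\le a_{ij}\le a_{i-1,j+1}$; row $i$ is $a_{i1},\dots,a_{i,n-i}$ (row $0$ is the top). Neighbors: $a_{ij}$ with $a_{i-1,j}$ and $a_{ij}$ with $a_{i-1,j+1}$. A triangle: top-left $a_{i-1,j}$, top-right $a_{i-1,j+1}$, bottom $a_{ij}$. An enhanced pattern is a GZ pattern with some entries encircled and some neighbor pairs joined by edges, such that: (1) all row-$0$ entries are encircled; (2) edge-joined entries are equal and the lower one is encircled; (3) for $1\le i\le n-2$, $a_{ij},a_{i,j+1}$ are both joined to $a_{i-1,j+1}$ iff both are joined to $a_{i+1,j}$; (4) if $a_{0j}=a_{0,j+1}$, then $a_{1j}$ is encircled and joined to both; (5) triangle with top-left $a$, top-right $b>a$, bottom $a$: the bottom is encircled and joined to top-left; (6) triangle with top-left $a$, top-right $b>a$, bottom $b$ encircled: the bottom is joined to top-right; (7)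 triangle with all entries equal whose two top entries are connected by a path of edges: the bottom is encircled and joined to both; (8) triangle with all entries equal and encircled bottom: the bottom is joined to at least one top entry. The highest vertex of a component is a vertex in the smallest-index row the component meets. -}

module Defs where

open import Data.Nat using (ℕ; zero; suc; _+_; _∸_; _≤_; _<_; _≟_)
open import Data.Bool using (Bool; true; false; not; _∧_)
open import Data.Product using (_×_; _,_; proj₁; proj₂; ∃-syntax)
open import Data.Sum using (_⊎_)
open import Data.List using (List; map; concatMap; upTo; length; filterᵇ; deduplicate)
open import Data.List.Relation.Unary.All using (All)
open import Data.List.Relation.Unary.Any using (Any)
open import Data.List.Relation.Unary.AllPairs using (AllPairs)
open import Relation.Binary.PropositionalEquality using (_≡_)
open import Relation.Binary.Construct.Closure.Symmetric using (SymClosure)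
open import Relation.Binary.Construct.Closure.ReflexiveTransitive using (Star)
open import Relation.Nullary using (¬_)

Pos : Set
Pos = ℕ × ℕ

row : Pos → ℕ
row = proj₁

Valid : ℕ → Pos → Set
Valid n (i , j) = i < n × 1 ≤ j × i + j ≤ n

-- Edge data: eL i j = true  means a_{ij} is joined to a_{i-1,j};
--            eR i j = true  means a_{ij} is joined to a_{i-1,j+1}.
-- (Only meaningful for i ≥ 1 and (i , j) valid.)
data Adj (n : ℕ) (eL eR : ℕ → ℕ → Bool) : Pos → Pos → Set where
  left  : ∀ {i j} → Valid n (suc i , j) → eL (suc i) j ≡ true →
          Adj n eL eR (suc i , j) (i , j)
  right : ∀ {i j} → Valid n (suc i , j) → eR (suc i) j ≡ true →
          Adj n eL eR (suc i , j) (i , suc j)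

Conn : (n : ℕ) (eL eR : ℕ → ℕ → Bool) → Pos → Pos → Set
Conn n eL eR = Star (SymClosure (Adj n eL eR))

-- Enhanced Gelfand--Zetlin pattern of size n; top row given by the
-- partition lam (lam k = λ_k for 1 ≤ k ≤ n).
record EnhancedGZ (n : ℕ) : Set where
  field
    lam   : ℕ → ℕ
    lam-partition : ∀ k → 1 ≤ k → suc k ≤ n → lam (suc k) ≤ lam k
    a     : ℕ → ℕ → ℕ
    circ  : ℕ → ℕ → Bool
    eL    : ℕ → ℕ → Bool
    eR    : ℕ → ℕ → Bool
    top       : ∀ j → Valid n (0 , j) → a 0 j ≡ lam (suc n ∸ j)
    interlace : ∀ i j → Valid n (suc i , j) →
                a i j ≤ a (suc i) j × a (suc i) j ≤ a i (suc j)
    c1  : ∀ j → Valid n (0 , j) → circ 0 j ≡ true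
    c2L : ∀ i j → Valid n (suc i , j) → eL (suc i) j ≡ true →
          a (suc i) j ≡ a i j × circ (suc i) j ≡ true
    c2R : ∀ i j → Valid n (suc i , j) → eR (suc i) j ≡ true →
          a (suc i) j ≡ a i (suc j) × circ (suc i) j ≡ true
    -- (3), for row i' = suc i with 1 ≤ i' ≤ n-2 and (i', j), (i', j+1) entries
    c3  : ∀ i j → Valid n (suc (suc i) , j) →
          (eR (suc i) j ∧ eL (suc i) (suc j)) ≡ (eL (suc (suc i)) j ∧ eR (suc (suc i)) j)
    c4  : ∀ j → Valid n (1 , j) → a 0 j ≡ a 0 (suc j) →
          circ 1 j ≡ true × eL 1 j ≡ true × eR 1 j ≡ true
    c5  : ∀ i j → Valid n (suc i , j) → a i j < a i (suc j) → a (suc i) j ≡ a i j →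
          circ (suc i) j ≡ true × eL (suc i) j ≡ true
    c6  : ∀ i j → Valid n (suc i , j) → a i j < a i (suc j) → a (suc i) j ≡ a i (suc j) →
          circ (suc i) j ≡ true → eR (suc i) j ≡ true
    c7  : ∀ i j → Valid n (suc i , j) → a i j ≡ a i (suc j) → a (suc i) j ≡ a i j →
          Conn n eL eR (i , j) (i , suc j) →
          circ (suc i) j ≡ true × eL (suc i) j ≡ true × eR (suc i) j ≡ true
    c8  : ∀ i j → Valid n (suc i , j) → a i j ≡ a i (suc j) → a (suc i) j ≡ a i j →
          circ (suc i) j ≡ true → eL (suc i) j ≡ true ⊎ eR (suc i) j ≡ true

module _ {n : ℕ} (P : EnhancedGZ n) where
  open EnhancedGZ P

  Connected : Pos → Pos → Set
  Connected = Conn n eL eR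

  circled : Pos → Bool
  circled (i , j) = circ i j

  positions : List Pos
  positions = concatMap (λ i → map (λ j → (i , suc j)) (upTo (n ∸ i))) (upTo n)

  nonCircledCount : ℕ
  nonCircledCount = length (filterᵇ (λ p → not (circled p)) positions)

  distinctLamCount : ℕ
  distinctLamCount = length (deduplicate _≟_ (map (λ k → lam (suc k)) (upTo n)))

  -- reps is a system of representatives of the connected components:
  -- one vertex from each component (so  length reps  = number of components)
  IsComponentReps : List Pos → Set
  IsComponentReps reps =
    All (Valid n) reps ×
    (∀ v → Valid n v → Any (Connected v) reps) ×
    AllPairs (λ r s → ¬ Connected r s) reps

  UniqueTop : Pos → Set
  UniqueTop v = ∃[ u ] (Valid n u × Connected v u ×
                        (∀ w → Connected v w → row u ≤ row w) ×
                        (∀ w → Connected v w → row w ≡ row u → w ≡ u))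

-- Edges only join equal entries, and the top row is weakly increasing and
-- joined through row 1 wherever it is constant (condition (4)); this gives (1).
-- The heart of the argument is that the set of vertices reached from a vertex u
-- with no upward edge by walking DOWN edges is closed under upward edges too:
-- if a vertex is joined to both vertices above it, condition (3) joins both of
-- those to their common upper neighbour. Hence the component of such a u lies
-- strictly below u, apart from u itself. Non-encircled
-- vertices have no upward edge by condition (2), which gives (3); climbing upward
-- edges from any vertex until none is left or row 0 is reached gives (2). For the
-- count, sending each top value to the component of its top entries and each
-- non-encircled vertex to its own component is injective by (1) and (3).
module Submission where

open import Defs
open import Data.Nat using (ℕ; _≤_; _<_; _+_)
open import Data.Bool using (false)
open import Data.Product using (_×_; _,_; ∃-syntax)
open import Data.Sum using (_⊎_)
open import Data.List using (List; length)
open import Function.Bundles using (_⇔_)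
open import Relation.Binary.PropositionalEquality using (_≡_)

open import Data.Nat using (zero; suc; _∸_; z≤n; s≤s; _≤′_; ≤′-refl; ≤′-step; _≟_)
open import Data.Nat.Properties
open import Data.Bool using (true; not; _∧_; T)
open import Data.Bool.Properties using (∧-conicalˡ; ∧-conicalʳ)
open import Data.Product using (proj₁; proj₂)
open import Data.Sum using (inj₁; inj₂)
open import Data.Empty using (⊥-elim)
open import Data.Fin using (Fin)
open import Data.Fin.Properties using (injective⇒≤)
open import Data.List using (_∷_; map; _++_; lookup; upTo; filterᵇ; deduplicate)
open import Data.List.Properties using (length-++; length-map)
open import Data.List.Relation.Unary.All as All using (All)
import Data.List.Relation.Unary.All.Properties as All
open import Data.List.Relation.Unary.Any as Any using (Any)
open import Data.List.Relation.Unary.Any.Properties using (lookup-index)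
open import Data.List.Relation.Unary.AllPairs as AllPairs using (_∷_)
import Data.List.Relation.Unary.AllPairs.Properties as AllPairs
open import Data.List.Relation.Unary.Unique.Propositional using (Unique)
import Data.List.Relation.Unary.Unique.Propositional.Properties as Unique
open import Data.List.Relation.Unary.Unique.DecPropositional.Properties using (deduplicate-!)
open import Data.List.Membership.Propositional using (_∈_; find)
open import Data.List.Membership.Propositional.Properties
open import Data.List.Relation.Binary.Disjoint.Propositional using (Disjoint)
open import Relation.Binary.PropositionalEquality using (refl; sym; trans; cong; cong₂; subst; _≢_)
open import Relation.Binary.Construct.Closure.Symmetric using (fwd; bwd)
open import Relation.Binary.Construct.Closure.ReflexiveTransitive using (ε; _◅_; _◅◅_)
import Relation.Binary.Construct.Closure.Equivalence as EqClosure
open import Relation.Nullary using (¬_; contradiction)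
open import Function.Bundles using (mk⇔; Equivalence)

lookup-injective : ∀ {A : Set} {xs : List A} → Unique xs →
                   ∀ i j → lookup xs i ≡ lookup xs j → i ≡ j
lookup-injective (_ ∷ _)   Fin.zero    Fin.zero    _  = refl
lookup-injective (x∉ ∷ _)  Fin.zero    (Fin.suc j) eq = contradiction eq (All.lookup x∉ (∈-lookup j))
lookup-injective (x∉ ∷ _)  (Fin.suc i) Fin.zero    eq = contradiction (sym eq) (All.lookup x∉ (∈-lookup i))
lookup-injective (_ ∷ xs!) (Fin.suc i) (Fin.suc j) eq = cong Fin.suc (lookup-injective xs! i j eq)

length-≤-by-cover : ∀ {A B : Set} (R : A → B → Set) {xs : List A} {ys : List B} →
                    Unique xs → (cover : ∀ {x} → x ∈ xs → Any (R x) ys) →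
                    (∀ {x x′ y} → R x y → R x′ y → x ≡ x′) → length xs ≤ length ys
length-≤-by-cover R {xs} {ys} xs! cover R-functional = injective⇒≤ {f = target} target-injective
  where
    target : Fin (length xs) → Fin (length ys)
    target i = Any.index (cover (∈-lookup i))

    target-injective : ∀ {i j} → target i ≡ target j → i ≡ j
    target-injective {i} {j} eq = lookup-injective xs! i j (R-functional Ri Rj)
      where
        Ri = lookup-index (cover (∈-lookup i))
        Rj = subst (λ k → R (lookup xs j) (lookup ys k)) (sym eq) (lookup-index (cover (∈-lookup j)))

module Pattern {n : ℕ} (P : EnhancedGZ n) where
  open EnhancedGZ P

  Edge : Pos → Pos → Set
  Edge = Adj n eL eR

  Connected-sym : ∀ {x y} → Connected P x y → Connected P y x
  Connected-sym = EqClosure.symmetric Edge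

  valid-upˡ : ∀ {i j} → Valid n (suc i , j) → Valid n (i , j)
  valid-upˡ (i<n , 1≤j , i+j≤n) = <⇒≤ i<n , 1≤j , <⇒≤ i+j≤n

  valid-upʳ : ∀ {i j} → Valid n (suc i , j) → Valid n (i , suc j)
  valid-upʳ {i} {j} (i<n , _ , i+j≤n) = <⇒≤ i<n , s≤s z≤n , ≤-trans (≤-reflexive (+-suc i j)) i+j≤n

  value : Pos → ℕ
  value (i , j) = a i j

  edge-value : ∀ {x y} → Edge x y → value x ≡ value y
  edge-value (left {i} {j} v e)  = proj₁ (c2L i j v e)
  edge-value (right {i} {j} v e) = proj₁ (c2R i j v e)

  connected-value : ∀ {x y} → Connected P x y → value x ≡ value y
  connected-value ε              = refl
  connected-value (fwd e ◅ path) = trans (edge-value e) (connected-value path)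
  connected-value (bwd e ◅ path) = trans (sym (edge-value e)) (connected-value path)

  edge-row : ∀ {x y} → Edge x y → row y < row x
  edge-row (left _ _)  = n<1+n _
  edge-row (right _ _) = n<1+n _

  row1-valid : ∀ {j} → 1 ≤ j → suc j ≤ n → Valid n (1 , j)
  row1-valid 1≤j j<n = ≤-trans (s≤s 1≤j) j<n , 1≤j , j<n

  top-step : ∀ {j} → 1 ≤ j → suc j ≤ n → a 0 j ≤ a 0 (suc j)
  top-step 1≤j j<n =
    let a0j≤a1j , a1j≤a0j+1 = interlace 0 _ (row1-valid 1≤j j<n) in ≤-trans a0j≤a1j a1j≤a0j+1

  top-monotone : ∀ {j k} → 1 ≤ j → j ≤′ k → k ≤ n → a 0 j ≤ a 0 k
  top-monotone 1≤j ≤′-refl         _   = ≤-refl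
  top-monotone 1≤j (≤′-step j≤′k) k<n =
    ≤-trans (top-monotone 1≤j j≤′k (<⇒≤ k<n)) (top-step (≤-trans 1≤j (≤′⇒≤ j≤′k)) k<n)

  top-neighbours-connected : ∀ {j} → 1 ≤ j → suc j ≤ n → a 0 j ≡ a 0 (suc j) →
                             Connected P (0 , j) (0 , suc j)
  top-neighbours-connected 1≤j j<n eq =
    let v = row1-valid 1≤j j<n ; _ , joinedˡ , joinedʳ = c4 _ v eq
    in bwd (left v joinedˡ) ◅ fwd (right v joinedʳ) ◅ ε

  equal-top-connected : ∀ {j k} → 1 ≤ j → j ≤′ k → k ≤ n → a 0 j ≡ a 0 k →
                        Connected P (0 , j) (0 , k)
  equal-top-connected 1≤j ≤′-refl          _   _  = ε
  equal-top-connected {j} 1≤j (≤′-step {k} j≤′k) k<n eq =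
    equal-top-connected 1≤j j≤′k (<⇒≤ k<n) eq′ ◅◅ top-neighbours-connected 1≤k k<n (trans (sym eq′) eq)
    where
      1≤k = ≤-trans 1≤j (≤′⇒≤ j≤′k)
      eq′ : a 0 j ≡ a 0 k
      eq′ = ≤-antisym (top-monotone 1≤j j≤′k (<⇒≤ k<n))
                      (≤-trans (top-step 1≤k k<n) (≤-reflexive (sym eq)))

  top-connected⇔equal : ∀ j k → Valid n (0 , j) → Valid n (0 , k) →
                        Connected P (0 , j) (0 , k) ⇔ a 0 j ≡ a 0 k
  top-connected⇔equal j k (_ , 1≤j , j≤n) (_ , 1≤k , k≤n) = mk⇔ connected-value from
    where
      from : a 0 j ≡ a 0 k → Connected P (0 , j) (0 , k)
      from eq with ≤-total j k
      ... | inj₁ j≤k = equal-top-connected 1≤j (≤⇒≤′ j≤k) k≤n eq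
      ... | inj₂ k≤j = Connected-sym (equal-top-connected 1≤k (≤⇒≤′ k≤j) j≤n (sym eq))

  NoUpEdge : Pos → Set
  NoUpEdge u = ∀ {y} → ¬ Edge u y

  data Descent (u : Pos) : Pos → Set where
    start   : Descent u u
    descend : ∀ {p x} → Descent u p → Edge x p → Descent u x

  descent-row≤ : ∀ {u w} → Descent u w → row u ≤ row w
  descent-row≤ start         = ≤-refl
  descent-row≤ (descend d e) = ≤-trans (descent-row≤ d) (<⇒≤ (edge-row e))

  descent-row : ∀ {u w} → Descent u w → row u < row w ⊎ w ≡ u
  descent-row start         = inj₂ refl
  descent-row (descend d e) = inj₁ (≤-<-trans (descent-row≤ d) (edge-row e))

  joined-below⇒joined-above : ∀ {i j} → Valid n (suc (suc i) , j) →
    eL (suc (suc i)) j ≡ true → eR (suc (suc i)) j ≡ true →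
    eR (suc i) j ≡ true × eL (suc i) (suc j) ≡ true
  joined-below⇒joined-above {i} {j} v joinedˡ joinedʳ =
    let both = trans (c3 i j v) (cong₂ _∧_ joinedˡ joinedʳ)
    in ∧-conicalˡ _ _ both , ∧-conicalʳ _ _ both

  descent-closed-up : ∀ {u} → 1 ≤ row u → NoUpEdge u →
                      ∀ {x y} → Descent u x → Edge x y → Descent u y
  descent-closed-up _   no-up start e = ⊥-elim (no-up e)
  descent-closed-up _   _ (descend d (left _ _))  (left _ _)  = d
  descent-closed-up _   _ (descend d (right _ _)) (right _ _) = d
  descent-closed-up 1≤u _ (descend d (left {zero} _ _))  (right _ _) =
    contradiction (≤-trans 1≤u (descent-row≤ d)) λ ()
  descent-closed-up 1≤u _ (descend d (right {zero} _ _)) (left _ _) =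
    contradiction (≤-trans 1≤u (descent-row≤ d)) λ ()
  descent-closed-up 1≤u no-up (descend d (left {suc i} v joinedˡ)) (right _ joinedʳ) =
    let p-up , y-up = joined-below⇒joined-above v joinedˡ joinedʳ
    in descend (descent-closed-up 1≤u no-up d (right (valid-upˡ v) p-up)) (left (valid-upʳ v) y-up)
  descent-closed-up 1≤u no-up (descend d (right {suc i} v joinedʳ)) (left _ joinedˡ) =
    let y-up , p-up = joined-below⇒joined-above v joinedˡ joinedʳ
    in descend (descent-closed-up 1≤u no-up d (left (valid-upʳ v) p-up)) (right (valid-upˡ v) y-up)

  descent-closed : ∀ {u} → 1 ≤ row u → NoUpEdge u →
                   ∀ {x w} → Descent u x → Connected P x w → Descent u w
  descent-closed 1≤u no-up d ε              = d
  descent-closed 1≤u no-up d (fwd e ◅ path) = descent-closed 1≤u no-up (descent-closed-up 1≤u no-up d e) path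
  descent-closed 1≤u no-up d (bwd e ◅ path) = descent-closed 1≤u no-up (descend d e) path

  component-below : ∀ {u} → 1 ≤ row u → NoUpEdge u →
                    ∀ {w} → Connected P u w → row u < row w ⊎ w ≡ u
  component-below 1≤u no-up path = descent-row (descent-closed 1≤u no-up start path)

  no-up-edge⇒UniqueTop : ∀ {u} → Valid n u → 1 ≤ row u → NoUpEdge u → UniqueTop P u
  no-up-edge⇒UniqueTop {u} valid 1≤u no-up = u , valid , ε , topmost , unique
    where
      topmost : ∀ w → Connected P u w → row u ≤ row w
      topmost w path with component-below 1≤u no-up path
      ... | inj₁ u<w  = <⇒≤ u<w
      ... | inj₂ refl = ≤-refl

      unique : ∀ w → Connected P u w → row w ≡ row u → w ≡ u
      unique w path same-row with component-below 1≤u no-up path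
      ... | inj₁ u<w = contradiction (sym same-row) (<⇒≢ u<w)
      ... | inj₂ w≡u = w≡u

  uncircled-no-up-edge : ∀ {v} → circled P v ≡ false → NoUpEdge v
  uncircled-no-up-edge uncircled (left {i} {j} v e)  = contradiction (trans (sym (proj₂ (c2L i j v e))) uncircled) λ ()
  uncircled-no-up-edge uncircled (right {i} {j} v e) = contradiction (trans (sym (proj₂ (c2R i j v e))) uncircled) λ ()

  uncircled-below-top : ∀ {v} → Valid n v → circled P v ≡ false → 1 ≤ row v
  uncircled-below-top {zero , j}  valid uncircled = contradiction (trans (sym (c1 j valid)) uncircled) λ ()
  uncircled-below-top {suc _ , _} _     _         = s≤s z≤n

  uncircled-highest : ∀ v → Valid n v → circled P v ≡ false →
                      ∀ w → Connected P v w → row v < row w ⊎ w ≡ v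
  uncircled-highest v valid uncircled w =
    component-below (uncircled-below-top valid uncircled) (uncircled-no-up-edge uncircled)

  UniqueTopOrMeetsTopRow : Pos → Set
  UniqueTopOrMeetsTopRow v = UniqueTop P v ⊎ ∃[ j ] (Valid n (0 , j) × Connected P v (0 , j))

  UniqueTopOrMeetsTopRow-resp : ∀ {v v′} → Connected P v v′ →
                                UniqueTopOrMeetsTopRow v′ → UniqueTopOrMeetsTopRow v
  UniqueTopOrMeetsTopRow-resp v~v′ (inj₁ (u , valid , v′~u , topmost , unique)) =
    inj₁ (u , valid , v~v′ ◅◅ v′~u ,
          (λ w v~w → topmost w (Connected-sym v~v′ ◅◅ v~w)) ,
          (λ w v~w → unique w (Connected-sym v~v′ ◅◅ v~w)))
  UniqueTopOrMeetsTopRow-resp v~v′ (inj₂ (j , valid , v′~top)) = inj₂ (j , valid , v~v′ ◅◅ v′~top)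

  climb : ∀ i j → Valid n (i , j) → UniqueTopOrMeetsTopRow (i , j)
  climb zero    j valid = inj₂ (j , valid , ε)
  climb (suc i) j valid with eL (suc i) j in joinedˡ | eR (suc i) j in joinedʳ
  ... | true  | _     = UniqueTopOrMeetsTopRow-resp (fwd (left valid joinedˡ) ◅ ε) (climb i j (valid-upˡ valid))
  ... | false | true  = UniqueTopOrMeetsTopRow-resp (fwd (right valid joinedʳ) ◅ ε) (climb i (suc j) (valid-upʳ valid))
  ... | false | false = inj₁ (no-up-edge⇒UniqueTop valid (s≤s z≤n) no-up)
    where
      no-up : NoUpEdge (suc i , j)
      no-up (left _ e)  = contradiction (trans (sym e) joinedˡ) λ ()
      no-up (right _ e) = contradiction (trans (sym e) joinedʳ) λ ()

  lamValues : List ℕ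
  lamValues = deduplicate _≟_ (map (λ k → lam (suc k)) (upTo n))

  uncircledEntries : List Pos
  uncircledEntries = filterᵇ (λ p → not (circled P p)) (positions P)

  ∈-lamValues⁻ : ∀ {x} → x ∈ lamValues → ∃[ j ] (Valid n (0 , j) × a 0 j ≡ x)
  ∈-lamValues⁻ x∈ with k , k∈ , refl ← ∈-map⁻ _ (∈-deduplicate⁻ _≟_ (map (λ k → lam (suc k)) (upTo n)) x∈) =
    n ∸ k , valid , trans (top (n ∸ k) valid) (cong lam column)
    where
      k<n = ∈-upTo⁻ k∈
      valid : Valid n (0 , n ∸ k)
      valid = ≤-trans (s≤s z≤n) k<n , m<n⇒0<n∸m k<n , m∸n≤m n k
      column : suc n ∸ (n ∸ k) ≡ suc k
      column = trans (+-∸-assoc 1 (m∸n≤m n k)) (cong suc (m∸[m∸n]≡n (<⇒≤ k<n)))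

  ∈-positions⁻ : ∀ {v} → v ∈ positions P → Valid n v
  ∈-positions⁻ v∈
    with i , i∈ , v∈row ← find (∈-concatMap⁻ _ {xs = upTo n} v∈)
    with j , j∈ , refl ← ∈-map⁻ _ v∈row =
    i<n , s≤s z≤n , ≤-trans (+-monoʳ-≤ i (∈-upTo⁻ j∈)) (≤-reflexive (m+[n∸m]≡n (<⇒≤ i<n)))
    where i<n = ∈-upTo⁻ i∈

  ∈-uncircledEntries⁻ : ∀ {v} → v ∈ uncircledEntries → Valid n v × circled P v ≡ false
  ∈-uncircledEntries⁻ v∈ with v∈positions , uncircled ← ∈-filter⁻ _ {xs = positions P} v∈ =
    ∈-positions⁻ v∈positions , not-true uncircled
    where
      not-true : ∀ {b} → T (not b) → b ≡ false
      not-true {false} _ = refl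

  positions-unique : Unique (positions P)
  positions-unique =
    Unique.concat⁺ (All.map⁺ (All.tabulate λ _ → Unique.map⁺ (λ eq → suc-injective (cong proj₂ eq)) (Unique.upTo⁺ _)))
                   (AllPairs.map⁺ (AllPairs.map rows-disjoint (Unique.upTo⁺ n)))
    where
      rows-disjoint : ∀ {i i′} → i ≢ i′ →
                      Disjoint (map (λ j → (i , suc j)) (upTo (n ∸ i))) (map (λ j → (i′ , suc j)) (upTo (n ∸ i′)))
      rows-disjoint i≢i′ (v∈i , v∈i′) with _ , _ , refl ← ∈-map⁻ _ v∈i | _ , _ , eq ← ∈-map⁻ _ v∈i′ =
        i≢i′ (cong proj₁ eq)

  Label : Set
  Label = ℕ ⊎ Pos

  labels : List Label
  labels = map inj₁ lamValues ++ map inj₂ uncircledEntries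

  labels-unique : Unique labels
  labels-unique = Unique.++⁺ (Unique.map⁺ inj₁-injective (deduplicate-! _≟_ _))
                             (Unique.map⁺ inj₂-injective (Unique.filter⁺ _ positions-unique))
                             disjoint
    where
      inj₁-injective : ∀ {x y : ℕ} → _≡_ {A = Label} (inj₁ x) (inj₁ y) → x ≡ y
      inj₁-injective refl = refl
      inj₂-injective : ∀ {x y : Pos} → _≡_ {A = Label} (inj₂ x) (inj₂ y) → x ≡ y
      inj₂-injective refl = refl
      disjoint : Disjoint (map inj₁ lamValues) (map inj₂ uncircledEntries)
      disjoint (l∈₁ , l∈₂) with _ , _ , refl ← ∈-map⁻ inj₁ l∈₁ | _ , _ , () ← ∈-map⁻ inj₂ l∈₂

  length-labels : length labels ≡ distinctLamCount P + nonCircledCount P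
  length-labels = trans (length-++ (map inj₁ lamValues))
                        (cong₂ _+_ (length-map inj₁ lamValues) (length-map inj₂ uncircledEntries))

  Labels : Label → Pos → Set
  Labels (inj₁ x) r = ∃[ j ] (Valid n (0 , j) × a 0 j ≡ x × Connected P (0 , j) r)
  Labels (inj₂ v) r = Valid n v × circled P v ≡ false × Connected P v r

  labels-covered : ∀ {reps} → (∀ v → Valid n v → Any (Connected P v) reps) →
                   ∀ {l} → l ∈ labels → Any (Labels l) reps
  labels-covered cover l∈ with ∈-++⁻ (map inj₁ lamValues) l∈
  ... | inj₁ l∈₁ with x , x∈ , refl ← ∈-map⁻ inj₁ l∈₁ with j , valid , eq ← ∈-lamValues⁻ x∈ =
    Any.map (λ top~r → j , valid , eq , top~r) (cover (0 , j) valid)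
  ... | inj₂ l∈₂ with v , v∈ , refl ← ∈-map⁻ inj₂ l∈₂ with valid , uncircled ← ∈-uncircledEntries⁻ v∈ =
    Any.map (λ v~r → valid , uncircled , v~r) (cover v valid)

  uncircled-not-top-labelled : ∀ {v x r} → Labels (inj₂ v) r → ¬ Labels (inj₁ x) r
  uncircled-not-top-labelled (valid , uncircled , v~r) (j , vj , _ , j~r)
    with uncircled-highest _ valid uncircled (0 , j) (v~r ◅◅ Connected-sym j~r)
  ... | inj₂ refl = contradiction (trans (sym (c1 j vj)) uncircled) λ ()

  Labels-functional : ∀ {l l′ r} → Labels l r → Labels l′ r → l ≡ l′
  Labels-functional {inj₁ _} {inj₁ _} (j , vj , refl , j~r) (k , vk , refl , k~r) =
    cong inj₁ (Equivalence.to (top-connected⇔equal j k vj vk) (j~r ◅◅ Connected-sym k~r))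
  Labels-functional {inj₁ _} {inj₂ _} top v = ⊥-elim (uncircled-not-top-labelled v top)
  Labels-functional {inj₂ _} {inj₁ _} v top = ⊥-elim (uncircled-not-top-labelled v top)
  Labels-functional {inj₂ v} {inj₂ v′} (valid , uncircled , v~r) (valid′ , uncircled′ , v′~r)
    with uncircled-highest v valid uncircled v′ (v~r ◅◅ Connected-sym v′~r)
       | uncircled-highest v′ valid′ uncircled′ v (v′~r ◅◅ Connected-sym v~r)
  ... | inj₂ v′≡v | _         = cong inj₂ (sym v′≡v)
  ... | inj₁ _    | inj₂ v≡v′ = cong inj₂ v≡v′
  ... | inj₁ v<v′ | inj₁ v′<v = contradiction v<v′ (<-asym v′<v)

  component-count-bound : ∀ reps → IsComponentReps P reps →
                          distinctLamCount P + nonCircledCount P ≤ length reps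
  component-count-bound reps (_ , cover , _) =
    subst (_≤ length reps) length-labels
      (length-≤-by-cover Labels labels-unique (labels-covered cover) Labels-functional)

open Pattern

lemma4p4 : ∀ (n : ℕ) (P : EnhancedGZ n) →
    -- (1)
    (∀ j k → Valid n (0 , j) → Valid n (0 , k) →
      (Connected P (0 , j) (0 , k) ⇔ EnhancedGZ.a P 0 j ≡ EnhancedGZ.a P 0 k)) ×
    -- (2)
    (∀ v → Valid n v →
      UniqueTop P v ⊎ (∃[ j ] (Valid n (0 , j) × Connected P v (0 , j)))) ×
    -- (3)
    (∀ v → Valid n v → circled P v ≡ false →
      ∀ w → Connected P v w → row v < row w ⊎ w ≡ v) ×
    -- (3, in particular)
    (∀ reps → IsComponentReps P reps →
      distinctLamCount P + nonCircledCount P ≤ length reps)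
lemma4p4 n P =
  top-connected⇔equal P ,
  (λ { (i , j) → climb P i j }) ,
  uncircled-highest P ,
  component-count-bound P
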